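{- Let $F$ be a formula and $\vec v$ a consistent vector, and let $R$ be any region with $F\overset{\vec v}{\Rightarrow}R$ (the generalization relation defined in the context). Then: (Invariant 1) $F[\vec v]=R[\vec v]$; (Invariant 2.a) if $F[\vec v]$ holds, then for every consistent vector $\vec w$, $R[\vec w]$ implies $F[\vec w]$; (Invariant 2.b) if $F[\vec v]$ does not hold, then for every consistent vector $\vec w$, $F[\vec w]$ implies $R[\vec w]$.
   Context: Variables $x_1,\dots,x_n$ are each of integer or rational type; index $k$ is the dimension of $x_k$. Polynomials are linear $c_nx_n+\dots+c_1x_1+c_0$ with rational $c_i$; the dimension of a polynomial is the largest $k$ with $c_k\ne0$. Vectors assign values to all variables; consistent vectors respect types; $E[\vec w]$ is evaluation. $\prec$ denotes $<$ or $\le$. Linear constraints are $P=Q$, $P<Q$, $P\le Q$, $P>Q$, $P\ge Q$; formulas are built from linear constraints by $\land,\lor,\lnot$. A variable bound is $x_k\prec P$, $P\prec x_k$ or $x_k=P$ with $\dim(P)<k$. A trapezoid is a finite set of such bounds, at most one equality or at most one upper and one lower bound per variable, all satisfied by $\vec v$; a region is $\{T\}$ (meaning the conjunction of the bounds of $T$) or ${\sim}\{T\}$ (its negation), so $\{\}$ is true and ${\sim}\{\}$ false. Atom generalization $\langle L\rangle\to R$: first $P\prec Q$ becomes $P-Q\prec0$, $P\succ Q$ becomes $Q-P\prec 0$, $P=Q$ becomes $P-Q=0$. A constant relation $c_0\prec0$ or $c_0=0$ gives $\{\}$ if true and ${\sim}\{\}$ if false. Otherwise, with leading term $c_kx_k$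 of $P_k$: $P_k<0$ becomes $x_k<-(P_k/c_k-x_k)$ if $c_k>0$ and $-(P_k/c_k-x_k)<x_k$ if $c_k<0$; likewise for $\le$; $P_k=0$ becomes $x_k=-(P_k/c_k-x_k)$. A resulting bound true at $\vec v$ gives the region $\{(\text{bound})\}$. If false at $\vec v$: $x_k<P$ gives ${\sim}\{(P\le x_k)\}$; $x_k\le P$ gives ${\sim}\{(P<x_k)\}$; $P<x_k$ gives ${\sim}\{(x_k\le P)\}$; $P\le x_k$ gives ${\sim}\{(x_k<P)\}$; $x_k=P$ gives ${\sim}\{(P<x_k)\}$ if $x_k[\vec v]>P[\vec v]$ and ${\sim}\{(x_k<P)\}$ if $x_k[\vec v]<P[\vec v]$. Region operations: ${\sim}{\sim}\{T\}=\{T\}$; $\{T^a\}\cap\{T^b\}=\{T^c\}$ where $T^c$ is obtained from the union of the bounds of $T^a,T^b$ by applying until none applies the rules that replace two bounds on one variable $x_m$: $(x_m<P)\cap(x_m<Q)\to(x_m<P)\cap\langle P\le Q\rangle$ if $P[\vec v]\le Q[\vec v]$; $(x_m<P)\cap(x_m\le Q)\to(x_m<P)\cap\langle P\le Q\rangle$ if $P[\vec v]\le Q[\vec v]$; $(x_m\le P)\cap(x_m<Q)\to(x_m\le P)\cap\langle P<Q\rangle$ if $P[\vec v]<Q[\vec v]$; $(x_m\le P)\cap(x_m\le Q)\to(x_m\le P)\cap\langle P\le Q\rangle$ if $P[\vec v]\le Q[\vec v]$; the symmetric rules for two lower bounds (keeping the larger-at-$\vec v$ lower bound $P$ and adding $\langle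 Q\le P\rangle$, or $\langle Q<P\rangle$ in the case $(P\le x_m)\cap(Q<x_m)$ with $Q[\vec v]<P[\vec v]$); $(x_m=P)\cap(x_m\prec Q)\to(x_m=P)\cap\langle P\prec Q\rangle$; $(x_m=P)\cap(Q\prec x_m)\to(x_m=P)\cap\langle Q\prec P\rangle$; $(x_m=P)\cap(x_m=Q)\to(x_m=P)\cap\langle P=Q\rangle$ (here $\langle\cdot\rangle$ is the atom normalization above, which yields $\{\}$ or a single bound); ${\sim}\{T\}\cap R={\sim}\{T\}$ and $R\cap{\sim}\{T\}={\sim}\{T\}$. Generalization $F\overset{\vec v}{\Rightarrow}R$ is defined inductively: an atom $L$ generalizes to its atom region; $F_1\land F_2$ to $R_1\cap R_2$; $\lnot F$ to ${\sim}R$; $F_1\lor F_2$ to ${\sim}({\sim}R_1\cap{\sim}R_2)$, where $F_i\overset{\vec v}{\Rightarrow}R_i$ and $\cap,{\sim}$ are the region operations above. -}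

module Defs where

open import Data.Nat using (ℕ; zero; suc)
open import Data.Integer using (ℤ)
open import Data.Fin using (Fin; zero; suc; fromℕ; inject₁; _≟_)
open import Data.Rational using (ℚ; 0ℚ; 1ℚ; _+_; _*_; -_; _-_; _<_; _≤_; _>_; _÷_; ≢-nonZero; _/_)
open import Data.Rational.Properties using (_<?_; _≤?_) renaming (_≟_ to _≟ℚ_)
open import Data.Product using (Σ; _×_; _,_)
open import Data.Sum using (_⊎_)
open import Data.Maybe using (Maybe; just; nothing)
open import Data.List using (List; []; _∷_; _++_)
open import Data.List.Relation.Unary.All using (All)
open import Data.List.Relation.Binary.Permutation.Propositional using (_↭_)
open import Relation.Binary.Construct.Closure.ReflexiveTransitive using (Star)
open import Relation.Binary.PropositionalEquality using (_≡_; _≢_)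
open import Relation.Nullary using (¬_; yes; no)

-- There are n variables; the variable x_k (k = 1..n, its dimension) is
-- represented by the index (k-1) : Fin n.  Larger Fin index = larger
-- dimension.

data VarType : Set where
  intT ratT : VarType

Vector : ℕ → Set
Vector n = Fin n → ℚ

IsInteger : ℚ → Set
IsInteger q = Σ ℤ λ z → q ≡ z / 1

Consistent : ∀ {n} → (Fin n → VarType) → Vector n → Set
Consistent {n} ty w = (i : Fin n) → ty i ≡ intT → IsInteger (w i)

record Poly (n : ℕ) : Set where
  constructor poly
  field
    const : ℚ
    coef  : Fin n → ℚ
open Poly public

sumFin : ∀ {n} → (Fin n → ℚ) → ℚ
sumFin {zero}  f = 0ℚ
sumFin {suc n} f = f zero + sumFin (λ i → f (suc i))

eval : ∀ {n} → Poly n → Vector n → ℚ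
eval P w = const P + sumFin (λ i → coef P i * w i)

constP : ∀ {n} → ℚ → Poly n
constP c = poly c (λ _ → 0ℚ)

varP : ∀ {n} → Fin n → Poly n
varP k = poly 0ℚ (λ i → δ i)
  where
  δ : _ → ℚ
  δ i with i ≟ k
  ... | yes _ = 1ℚ
  ... | no  _ = 0ℚ

negP : ∀ {n} → Poly n → Poly n
negP P = poly (- const P) (λ i → - coef P i)

subP : ∀ {n} → Poly n → Poly n → Poly n
subP P Q = poly (const P - const Q) (λ i → coef P i - coef Q i)

divP : ∀ {n} → Poly n → (c : ℚ) → c ≢ 0ℚ → Poly n
divP P c c≢0 = poly (_÷_ (const P) c {{≢-nonZero c≢0}})
                    (λ i → _÷_ (coef P i) c {{≢-nonZero c≢0}})

-- Leading term: the largest index k with c_k ≢ 0 (the dimension of the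
-- polynomial), together with c_k and a proof that it is nonzero;
-- nothing if all c_i are zero (dimension 0, a constant).
record Lead (n : ℕ) : Set where
  constructor lead
  field
    idx  : Fin n
    lc   : ℚ
    lc≢0 : lc ≢ 0ℚ

leading : ∀ {n} → (Fin n → ℚ) → Maybe (Lead n)
leading {zero}  c = nothing
leading {suc n} c with c (fromℕ n) ≟ℚ 0ℚ
... | no  ≢0 = just (lead (fromℕ n) (c (fromℕ n)) ≢0)
... | yes _  with leading {n} (λ i → c (inject₁ i))
...   | nothing = nothing
...   | just (lead k a a≢0) = just (lead (inject₁ k) a a≢0)

data RelOp : Set where
  EQ LT LE GT GE : RelOp

record Constraint (n : ℕ) : Set where
  constructor _⟨_⟩_
  field
    lhs : Poly n
    op  : RelOp
    rhs : Poly n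

data Formula (n : ℕ) : Set where
  atom : Constraint n → Formula n
  _∧F_ : Formula n → Formula n → Formula n
  _∨F_ : Formula n → Formula n → Formula n
  ¬F_  : Formula n → Formula n

holdsRel : RelOp → ℚ → ℚ → Set
holdsRel EQ p q = p ≡ q
holdsRel LT p q = p < q
holdsRel LE p q = p ≤ q
holdsRel GT p q = p > q
holdsRel GE p q = q ≤ p

holdsC : ∀ {n} → Constraint n → Vector n → Set
holdsC (P ⟨ o ⟩ Q) w = holdsRel o (eval P w) (eval Q w)

holdsF : ∀ {n} → Formula n → Vector n → Set
holdsF (atom L) w = holdsC L w
holdsF (F ∧F G) w = holdsF F w × holdsF G w
holdsF (F ∨F G) w = holdsF F w ⊎ holdsF G w
holdsF (¬F F)   w = ¬ holdsF F w

data BoundKind : Set where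
  ltU leU ltL leL eqB : BoundKind

record Bound (n : ℕ) : Set where
  constructor bound
  field
    var  : Fin n
    kind : BoundKind
    bpol : Poly n
open Bound public

holdsB : ∀ {n} → Bound n → Vector n → Set
holdsB (bound k ltU P) w = w k < eval P w
holdsB (bound k leU P) w = w k ≤ eval P w
holdsB (bound k ltL P) w = eval P w < w k
holdsB (bound k leL P) w = eval P w ≤ w k
holdsB (bound k eqB P) w = w k ≡ eval P w

-- a trapezoid is a finite set of bounds (represented as a list)
Trapezoid : ℕ → Set
Trapezoid n = List (Bound n)

data Region (n : ℕ) : Set where
  pos : Trapezoid n → Region n
  neg : Trapezoid n → Region n

holdsT : ∀ {n} → Trapezoid n → Vector n → Set
holdsT T w = All (λ b → holdsB b w) T

holdsR : ∀ {n} → Region n → Vector n → Set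
holdsR (pos T) w = holdsT T w
holdsR (neg T) w = ¬ holdsT T w

∼_ : ∀ {n} → Region n → Region n
∼ pos T = neg T
∼ neg T = pos T

data NRel : Set where
  nlt nle neq : NRel

holdsN : NRel → ℚ → ℚ → Set
holdsN nlt p q = p < q
holdsN nle p q = p ≤ q
holdsN neq p q = p ≡ q

normalize : ∀ {n} → Constraint n → Poly n × NRel
normalize (P ⟨ EQ ⟩ Q) = subP P Q , neq
normalize (P ⟨ LT ⟩ Q) = subP P Q , nlt
normalize (P ⟨ LE ⟩ Q) = subP P Q , nle
normalize (P ⟨ GT ⟩ Q) = subP Q P , nlt
normalize (P ⟨ GE ⟩ Q) = subP Q P , nle

constRegion : ∀ {n} → NRel → ℚ → Region n
constRegion nlt c with c <? 0ℚ
... | yes _ = pos []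
... | no  _ = neg []
constRegion nle c with c ≤? 0ℚ
... | yes _ = pos []
... | no  _ = neg []
constRegion neq c with c ≟ℚ 0ℚ
... | yes _ = pos []
... | no  _ = neg []

leadBound : ∀ {n} → NRel → Poly n → Lead n → Bound n
leadBound r P (lead k c c≢0) = pick r (c <? 0ℚ)
  where
  B = negP (subP (divP P c c≢0) (varP k))
  pick : NRel → _ → Bound _
  pick nlt (no  _) = bound k ltU B
  pick nlt (yes _) = bound k ltL B
  pick nle (no  _) = bound k leU B
  pick nle (yes _) = bound k leL B
  pick neq _       = bound k eqB B

boundRegion : ∀ {n} → Vector n → Bound n → Region n
boundRegion v (bound k ltU P) with v k <? eval P v
... | yes _ = pos (bound k ltU P ∷ [])
... | no  _ = neg (bound k leL P ∷ [])
boundRegion v (bound k leU P) with v k ≤? eval P v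
... | yes _ = pos (bound k leU P ∷ [])
... | no  _ = neg (bound k ltL P ∷ [])
boundRegion v (bound k ltL P) with eval P v <? v k
... | yes _ = pos (bound k ltL P ∷ [])
... | no  _ = neg (bound k leU P ∷ [])
boundRegion v (bound k leL P) with eval P v ≤? v k
... | yes _ = pos (bound k leL P ∷ [])
... | no  _ = neg (bound k ltU P ∷ [])
boundRegion v (bound k eqB P) with v k ≟ℚ eval P v
... | yes _ = pos (bound k eqB P ∷ [])
... | no  _ with eval P v <? v k
...   | yes _ = neg (bound k ltL P ∷ [])
...   | no  _ = neg (bound k ltU P ∷ [])

atomRegion : ∀ {n} → Vector n → Constraint n → Region n
atomRegion v L with normalize L
... | P , r with leading (coef P)
...   | nothing = constRegion r (const P)
...   | just ld = boundRegion v (leadBound r P ld)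

-- Combine v b₁ b₂ b T₀ : the pair b₁ ∩ b₂ (two bounds on the same
-- variable) is replaced by b ∩ <side>, where the side condition region
-- <side> = {T₀} (T₀ is empty or a single bound).
data Combine {n : ℕ} (v : Vector n) : Bound n → Bound n → Bound n → Trapezoid n → Set where
  uu-ltlt : ∀ {m P Q T₀} → eval P v ≤ eval Q v → atomRegion v (P ⟨ LE ⟩ Q) ≡ pos T₀ →
            Combine v (bound m ltU P) (bound m ltU Q) (bound m ltU P) T₀
  uu-ltle : ∀ {m P Q T₀} → eval P v ≤ eval Q v → atomRegion v (P ⟨ LE ⟩ Q) ≡ pos T₀ →
            Combine v (bound m ltU P) (bound m leU Q) (bound m ltU P) T₀
  uu-lelt : ∀ {m P Q T₀} → eval P v < eval Q v → atomRegion v (P ⟨ LT ⟩ Q) ≡ pos T₀ →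
            Combine v (bound m leU P) (bound m ltU Q) (bound m leU P) T₀
  uu-lele : ∀ {m P Q T₀} → eval P v ≤ eval Q v → atomRegion v (P ⟨ LE ⟩ Q) ≡ pos T₀ →
            Combine v (bound m leU P) (bound m leU Q) (bound m leU P) T₀
  ll-ltlt : ∀ {m P Q T₀} → eval Q v ≤ eval P v → atomRegion v (Q ⟨ LE ⟩ P) ≡ pos T₀ →
            Combine v (bound m ltL P) (bound m ltL Q) (bound m ltL P) T₀
  ll-ltle : ∀ {m P Q T₀} → eval Q v ≤ eval P v → atomRegion v (Q ⟨ LE ⟩ P) ≡ pos T₀ →
            Combine v (bound m ltL P) (bound m leL Q) (bound m ltL P) T₀
  ll-lelt : ∀ {m P Q T₀} → eval Q v < eval P v → atomRegion v (Q ⟨ LT ⟩ P) ≡ pos T₀ →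
            Combine v (bound m leL P) (bound m ltL Q) (bound m leL P) T₀
  ll-lele : ∀ {m P Q T₀} → eval Q v ≤ eval P v → atomRegion v (Q ⟨ LE ⟩ P) ≡ pos T₀ →
            Combine v (bound m leL P) (bound m leL Q) (bound m leL P) T₀
  eq-ltU  : ∀ {m P Q T₀} → atomRegion v (P ⟨ LT ⟩ Q) ≡ pos T₀ →
            Combine v (bound m eqB P) (bound m ltU Q) (bound m eqB P) T₀
  eq-leU  : ∀ {m P Q T₀} → atomRegion v (P ⟨ LE ⟩ Q) ≡ pos T₀ →
            Combine v (bound m eqB P) (bound m leU Q) (bound m eqB P) T₀
  eq-ltL  : ∀ {m P Q T₀} → atomRegion v (Q ⟨ LT ⟩ P) ≡ pos T₀ →
            Combine v (bound m eqB P) (bound m ltL Q) (bound m eqB P) T₀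
  eq-leL  : ∀ {m P Q T₀} → atomRegion v (Q ⟨ LE ⟩ P) ≡ pos T₀ →
            Combine v (bound m eqB P) (bound m leL Q) (bound m eqB P) T₀
  eq-eq   : ∀ {m P Q T₀} → atomRegion v (P ⟨ EQ ⟩ Q) ≡ pos T₀ →
            Combine v (bound m eqB P) (bound m eqB Q) (bound m eqB P) T₀

-- one rewriting step on a set of bounds: pick two of them (any order,
-- via a permutation) and replace them according to a rule
data Step {n : ℕ} (v : Vector n) : Trapezoid n → Trapezoid n → Set where
  step : ∀ {T b₁ b₂ rest b T₀} →
         T ↭ (b₁ ∷ b₂ ∷ rest) → Combine v b₁ b₂ b T₀ →
         Step v T (b ∷ T₀ ++ rest)

Normal : ∀ {n} → Vector n → Trapezoid n → Set
Normal v T = ∀ T′ → ¬ Step v T T′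

-- Inter v R₁ R₂ R : R is a possible result of R₁ ∩ R₂ at v
data Inter {n : ℕ} (v : Vector n) : Region n → Region n → Region n → Set where
  pospos : ∀ {Ta Tb Tc} → Star (Step v) (Ta ++ Tb) Tc → Normal v Tc →
           Inter v (pos Ta) (pos Tb) (pos Tc)
  negˡ   : ∀ {T R} → Inter v (neg T) R (neg T)
  negʳ   : ∀ {T R} → Inter v R (neg T) (neg T)

data Gen {n : ℕ} (v : Vector n) : Formula n → Region n → Set where
  gen-atom : ∀ {L} → Gen v (atom L) (atomRegion v L)
  gen-and  : ∀ {F₁ F₂ R₁ R₂ R} → Gen v F₁ R₁ → Gen v F₂ R₂ →
             Inter v R₁ R₂ R → Gen v (F₁ ∧F F₂) R
  gen-not  : ∀ {F R} → Gen v F R → Gen v (¬F F) (∼ R)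
  gen-or   : ∀ {F₁ F₂ R₁ R₂ R} → Gen v F₁ R₁ → Gen v F₂ R₂ →
             Inter v (∼ R₁) (∼ R₂) R → Gen v (F₁ ∨F F₂) (∼ R)

module Submission where

-- The proof is by induction on the derivation of F ⇒[v] R, carrying one
-- invariant which strengthens Invariants 1, 2.a and 2.b together:
-- "R generalizes the property S at v" means that the trapezoid T of
-- R = {T} or R = ~{T} holds at v, and either S v holds and {T} ⊆ S, or
-- S v fails and S ⊆ ~{T}.  The extra fact T[v] is what makes intersection
-- work, because the rewriting rules for two bounds on one variable are
-- chosen by the values of the bounds at v.
--
-- Then the invariant is established for atom regions,
-- complements and intersections (the latter via the soundness of each
-- rewriting rule); disjunction follows from De Morgan's law, valid since
-- formulas are decidable.  The theorem is read off from the invariant;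
-- Invariants 2.a and 2.b in fact hold for all vectors w, consistent or not.

open import Defs
open import Data.Nat using (ℕ)
open import Data.Fin using (Fin)
open import Data.Product using (_×_)
open import Function.Bundles using (_⇔_)
open import Relation.Nullary using (¬_)

open import Data.Nat using (zero; suc)
open import Data.Fin using (zero; suc; fromℕ; inject₁)
import Data.Fin as Fin
open import Data.Fin.Properties using (suc-injective)
open import Data.Fin.Relation.Unary.Top using (view; ‵fromℕ; ‵inj₁)
open import Data.Product using (_,_; proj₁; proj₂; map)
open import Data.Sum using (_⊎_; inj₁; inj₂; [_,_])
open import Data.Empty using (⊥-elim)
open import Data.Maybe using (just; nothing)
open import Data.List using ([]; _∷_; _++_)
open import Data.List.Relation.Unary.All using ([]; _∷_; head)
open import Data.List.Relation.Unary.All.Properties using (++⁺; ++⁻)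
open import Data.List.Relation.Binary.Permutation.Propositional using (↭-sym)
open import Data.List.Relation.Binary.Permutation.Propositional.Properties using (All-resp-↭)
open import Data.Rational
  using (ℚ; 0ℚ; 1ℚ; _+_; _*_; -_; _-_; _<_; _≤_; 1/_; Positive; Negative; NonZero; positive; negative; ≢-nonZero)
open import Data.Rational.Properties
open import Data.Rational.Solver using (module +-*-Solver)
open import Function using (_∘_)
open import Function.Bundles using (mk⇔; Equivalence)
open import Function.Properties.Equivalence using () renaming (trans to ⇔-trans; sym to ⇔-sym)
open import Relation.Nullary using (Dec; yes; no)
open import Relation.Nullary.Decidable using (_×-dec_; _⊎-dec_; ¬?; decidable-stable)
open import Relation.Binary using (tri<; tri≈; tri>)
open import Relation.Binary.PropositionalEquality
  using (_≡_; _≢_; refl; sym; trans; cong; cong₂; subst; subst₂; module ≡-Reasoning)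
open import Relation.Binary.Construct.Closure.ReflexiveTransitive using (Star; ε; _◅_)

open +-*-Solver using (solve; _:+_; _:*_; _:-_; :-_; _:=_)

sumFin-cong : ∀ {n} {f g : Fin n → ℚ} → (∀ i → f i ≡ g i) → sumFin f ≡ sumFin g
sumFin-cong {zero}  f≗g = refl
sumFin-cong {suc n} f≗g = cong₂ _+_ (f≗g zero) (sumFin-cong (f≗g ∘ suc))

sumFin-+ : ∀ {n} (f g : Fin n → ℚ) → sumFin (λ i → f i + g i) ≡ sumFin f + sumFin g
sumFin-+ {zero}  f g = refl
sumFin-+ {suc n} f g = trans
  (cong (f zero + g zero +_) (sumFin-+ (f ∘ suc) (g ∘ suc)))
  (solve 4 (λ a b c d → (a :+ b) :+ (c :+ d) := (a :+ c) :+ (b :+ d)) refl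
     (f zero) (g zero) (sumFin (f ∘ suc)) (sumFin (g ∘ suc)))

sumFin-*ʳ : ∀ {n} (f : Fin n → ℚ) d → sumFin (λ i → f i * d) ≡ sumFin f * d
sumFin-*ʳ {zero}  f d = sym (*-zeroˡ d)
sumFin-*ʳ {suc n} f d = trans
  (cong (f zero * d +_) (sumFin-*ʳ (f ∘ suc) d))
  (sym (*-distribʳ-+ d (f zero) (sumFin (f ∘ suc))))

sumFin-neg : ∀ {n} (f : Fin n → ℚ) → sumFin (λ i → - f i) ≡ - sumFin f
sumFin-neg {zero}  f = refl
sumFin-neg {suc n} f = trans
  (cong (- f zero +_) (sumFin-neg (f ∘ suc)))
  (sym (neg-distrib-+ (f zero) (sumFin (f ∘ suc))))

sumFin-zero : ∀ {n} (f : Fin n → ℚ) → (∀ i → f i ≡ 0ℚ) → sumFin f ≡ 0ℚ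
sumFin-zero {zero}  f f≗0 = refl
sumFin-zero {suc n} f f≗0 = cong₂ _+_ (f≗0 zero) (sumFin-zero (f ∘ suc) (f≗0 ∘ suc))

sumFin-single : ∀ {n} (k : Fin n) (f : Fin n → ℚ) → (∀ i → i ≢ k → f i ≡ 0ℚ) → sumFin f ≡ f k
sumFin-single zero f f≗0 = trans
  (cong (f zero +_) (sumFin-zero (f ∘ suc) (λ i → f≗0 (suc i) (λ ()))))
  (+-identityʳ (f zero))
sumFin-single (suc k) f f≗0 = trans
  (cong₂ _+_ (f≗0 zero (λ ()))
             (sumFin-single k (f ∘ suc) (λ i i≢k → f≗0 (suc i) (i≢k ∘ suc-injective))))
  (+-identityˡ (f (suc k)))

module _ {n : ℕ} where

  linearPart : Poly n → Vector n → ℚ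
  linearPart P w = sumFin (λ i → coef P i * w i)

  eval-subP : ∀ (P Q : Poly n) w → eval (subP P Q) w ≡ eval P w - eval Q w
  eval-subP P Q w = begin
    (const P - const Q) + sumFin (λ i → (coef P i - coef Q i) * w i)
      ≡⟨ cong (const P - const Q +_) homogeneous ⟩
    (const P - const Q) + (linearPart P w - linearPart Q w)
      ≡⟨ solve 4 (λ a b s t → (a :- b) :+ (s :- t) := (a :+ s) :- (b :+ t)) refl
           (const P) (const Q) (linearPart P w) (linearPart Q w) ⟩
    eval P w - eval Q w ∎
    where
    open ≡-Reasoning
    homogeneous : sumFin (λ i → (coef P i - coef Q i) * w i) ≡ linearPart P w - linearPart Q w
    homogeneous = begin
      sumFin (λ i → (coef P i - coef Q i) * w i)
        ≡⟨ sumFin-cong (λ i → solve 3 (λ a b x → (a :- b) :* x := a :* x :+ (:- (b :* x))) refl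
                                (coef P i) (coef Q i) (w i)) ⟩
      sumFin (λ i → coef P i * w i + - (coef Q i * w i))
        ≡⟨ sumFin-+ (λ i → coef P i * w i) (λ i → - (coef Q i * w i)) ⟩
      linearPart P w + sumFin (λ i → - (coef Q i * w i))
        ≡⟨ cong (linearPart P w +_) (sumFin-neg (λ i → coef Q i * w i)) ⟩
      linearPart P w - linearPart Q w ∎

  eval-negP : ∀ (P : Poly n) w → eval (negP P) w ≡ - eval P w
  eval-negP P w = trans
    (cong (- const P +_) (trans (sumFin-cong (λ i → sym (neg-distribˡ-* (coef P i) (w i))))
                                (sumFin-neg (λ i → coef P i * w i))))
    (sym (neg-distrib-+ (const P) (linearPart P w)))

  eval-divP : ∀ (P : Poly n) c (c≢0 : c ≢ 0ℚ) w →
              eval (divP P c c≢0) w ≡ eval P w * (1/ c) {{≢-nonZero c≢0}}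
  eval-divP P c c≢0 w = trans
    (cong (const P * d +_) (trans (sumFin-cong (λ i → *-right-comm (coef P i) d (w i)))
                                  (sumFin-*ʳ (λ i → coef P i * w i) d)))
    (sym (*-distribʳ-+ d (const P) (linearPart P w)))
    where
    d = (1/ c) {{≢-nonZero c≢0}}
    *-right-comm : ∀ a b x → a * b * x ≡ a * x * b
    *-right-comm = solve 3 (λ a b x → (a :* b) :* x := (a :* x) :* b) refl

  eval-varP : ∀ (k : Fin n) w → eval (varP k) w ≡ w k
  eval-varP k w = trans (+-identityˡ _) (trans
    (sumFin-single k (λ i → coef (varP k) i * w i)
       (λ i i≢k → trans (cong (_* w i) (coef-off i i≢k)) (*-zeroˡ (w i))))
    (trans (cong (_* w k) coef-on) (*-identityˡ (w k))))
    where
    coef-off : ∀ i → i ≢ k → coef (varP k) i ≡ 0ℚ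
    coef-off i i≢k with i Fin.≟ k
    ... | yes i≡k = ⊥-elim (i≢k i≡k)
    ... | no  _   = refl
    coef-on : coef (varP k) k ≡ 1ℚ
    coef-on with k Fin.≟ k
    ... | yes _   = refl
    ... | no  k≢k = ⊥-elim (k≢k refl)

  eval-constant : ∀ (P : Poly n) w → (∀ i → coef P i ≡ 0ℚ) → eval P w ≡ const P
  eval-constant P w coef≡0 = trans
    (cong (const P +_) (sumFin-zero _ (λ i → trans (cong (_* w i) (coef≡0 i)) (*-zeroˡ (w i)))))
    (+-identityʳ (const P))

leading-nothing : ∀ {n} (c : Fin n → ℚ) → leading c ≡ nothing → ∀ i → c i ≡ 0ℚ
leading-nothing {suc n} c eq i with c (fromℕ n) ≟ 0ℚ
leading-nothing {suc n} c () i | no _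
... | yes cₙ≡0 with leading {n} (c ∘ inject₁) in eq′
...   | nothing with view i
...     | ‵fromℕ       = cₙ≡0
...     | ‵inj₁ {i = j} _ = leading-nothing (c ∘ inject₁) eq′ j
leading-nothing {suc n} c () i | yes _ | just _

<⇒≱ : ∀ {a b} → a < b → ¬ b ≤ a
<⇒≱ a<b b≤a = <-irrefl refl (<-≤-trans a<b b≤a)

≤⇒≯ : ∀ {a b} → a ≤ b → ¬ b < a
≤⇒≯ a≤b b<a = <⇒≱ b<a a≤b

≤∧≢⇒< : ∀ {a b} → a ≤ b → a ≢ b → a < b
≤∧≢⇒< {a} {b} a≤b a≢b with <-cmp a b
... | tri< a<b _ _ = a<b
... | tri≈ _ a≡b _ = ⊥-elim (a≢b a≡b)
... | tri> _ _ b<a = ⊥-elim (≤⇒≯ a≤b b<a)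

holdsN-≡ : ∀ r {a a′ b b′} → a ≡ a′ → b ≡ b′ → holdsN r a b ⇔ holdsN r a′ b′
holdsN-≡ r a≡a′ b≡b′ = mk⇔ (subst₂ (holdsN r) a≡a′ b≡b′) (subst₂ (holdsN r) (sym a≡a′) (sym b≡b′))

holdsN-+ʳ : ∀ r {a b} t → holdsN r a b → holdsN r (a + t) (b + t)
holdsN-+ʳ nlt t = +-monoˡ-< t
holdsN-+ʳ nle t = +-monoˡ-≤ t
holdsN-+ʳ neq t = cong (_+ t)

holdsN-shift : ∀ r a b t → holdsN r a b ⇔ holdsN r (a + t) (b + t)
holdsN-shift r a b t = mk⇔ (holdsN-+ʳ r t)
  (λ h → subst₂ (holdsN r) (cancel a) (cancel b) (holdsN-+ʳ r (- t) h))
  where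
  cancel : ∀ x → x + t - t ≡ x
  cancel x = solve 2 (λ x t → (x :+ t) :- t := x) refl x t

holdsN-sub : ∀ r a b → holdsN r a b ⇔ holdsN r (a - b) 0ℚ
holdsN-sub r a b = ⇔-trans (holdsN-shift r a b (- b)) (holdsN-≡ r refl (+-inverseʳ b))

holdsN-sub′ : ∀ r a b → holdsN r a b ⇔ holdsN r 0ℚ (b - a)
holdsN-sub′ r a b = ⇔-trans (holdsN-shift r a b (- a)) (holdsN-≡ r (+-inverseʳ a) refl)

≡0-scale : ∀ p d .{{_ : NonZero d}} → p ≡ 0ℚ ⇔ p * d ≡ 0ℚ
≡0-scale p d = mk⇔ (λ p≡0 → trans (cong (_* d) p≡0) (*-zeroˡ d)) (λ pd≡0 → begin
  p               ≡⟨ sym (*-identityʳ p) ⟩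
  p * 1ℚ          ≡⟨ cong (p *_) (sym (*-inverseʳ d)) ⟩
  p * (d * 1/ d)  ≡⟨ sym (*-assoc p d (1/ d)) ⟩
  p * d * 1/ d    ≡⟨ cong (_* 1/ d) pd≡0 ⟩
  0ℚ * 1/ d       ≡⟨ *-zeroˡ (1/ d) ⟩
  0ℚ              ∎)
  where open ≡-Reasoning

scale-pos : ∀ r p d .{{_ : Positive d}} → holdsN r p 0ℚ ⇔ holdsN r (p * d) 0ℚ
scale-pos nlt p d = mk⇔
  (λ p<0 → subst (p * d <_) (*-zeroˡ d) (*-monoˡ-<-pos d p<0))
  (λ pd<0 → *-cancelʳ-<-nonNeg d {{pos⇒nonNeg d}} (subst (p * d <_) (sym (*-zeroˡ d)) pd<0))
scale-pos nle p d = mk⇔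
  (λ p≤0 → subst (p * d ≤_) (*-zeroˡ d) (*-monoʳ-≤-nonNeg d {{pos⇒nonNeg d}} p≤0))
  (λ pd≤0 → *-cancelʳ-≤-pos d (subst (p * d ≤_) (sym (*-zeroˡ d)) pd≤0))
scale-pos neq p d = ≡0-scale p d {{pos⇒nonZero d}}

scale-neg : ∀ r p d .{{_ : Negative d}} → holdsN r p 0ℚ ⇔ holdsN r 0ℚ (p * d)
scale-neg nlt p d = mk⇔
  (λ p<0 → subst (_< p * d) (*-zeroˡ d) (*-monoˡ-<-neg d p<0))
  (λ 0<pd → *-cancelʳ-<-nonPos d {{neg⇒nonPos d}} (subst (_< p * d) (sym (*-zeroˡ d)) 0<pd))
scale-neg nle p d = mk⇔
  (λ p≤0 → subst (_≤ p * d) (*-zeroˡ d) (*-monoʳ-≤-nonPos d {{neg⇒nonPos d}} p≤0))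
  (λ 0≤pd → *-cancelʳ-≤-neg d (subst (_≤ p * d) (sym (*-zeroˡ d)) 0≤pd))
scale-neg neq p d = ⇔-trans (≡0-scale p d {{neg⇒nonZero d}}) (mk⇔ sym sym)

sub-sound : ∀ {n} r (P Q : Poly n) w → holdsN r (eval P w) (eval Q w) ⇔ holdsN r (eval (subP P Q) w) 0ℚ
sub-sound r P Q w = ⇔-trans (holdsN-sub r _ _) (holdsN-≡ r (sym (eval-subP P Q w)) refl)

normalize-sound : ∀ {n} (L : Constraint n) w →
  holdsC L w ⇔ holdsN (proj₂ (normalize L)) (eval (proj₁ (normalize L)) w) 0ℚ
normalize-sound (P ⟨ EQ ⟩ Q) w = sub-sound neq P Q w
normalize-sound (P ⟨ LT ⟩ Q) w = sub-sound nlt P Q w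
normalize-sound (P ⟨ LE ⟩ Q) w = sub-sound nle P Q w
normalize-sound (P ⟨ GT ⟩ Q) w = sub-sound nlt Q P w
normalize-sound (P ⟨ GE ⟩ Q) w = sub-sound nle Q P w

leading-gap : ∀ {n} (P : Poly n) k c (c≢0 : c ≢ 0ℚ) w →
  w k - eval (negP (subP (divP P c c≢0) (varP k))) w ≡ eval P w * (1/ c) {{≢-nonZero c≢0}}
leading-gap P k c c≢0 w = begin
  w k - eval (negP (subP (divP P c c≢0) (varP k))) w
    ≡⟨ cong (λ b → w k - b) (eval-negP P/c-xₖ w) ⟩
  w k - - eval P/c-xₖ w
    ≡⟨ cong (λ b → w k - - b) (eval-subP (divP P c c≢0) (varP k) w) ⟩
  w k - - (eval (divP P c c≢0) w - eval (varP k) w)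
    ≡⟨ cong₂ (λ p x → w k - - (p - x)) (eval-divP P c c≢0 w) (eval-varP k w) ⟩
  w k - - (eval P w * d - w k)
    ≡⟨ solve 2 (λ x q → x :- (:- (q :- x)) := q) refl (w k) (eval P w * d) ⟩
  eval P w * d ∎
  where
  open ≡-Reasoning
  d = (1/ c) {{≢-nonZero c≢0}}
  P/c-xₖ = subP (divP P c c≢0) (varP k)

upper-bound-sound : ∀ r {x b p} d .{{_ : Positive d}} → x - b ≡ p * d → holdsN r x b ⇔ holdsN r p 0ℚ
upper-bound-sound r {x} {b} {p} d gap =
  ⇔-trans (holdsN-sub r x b) (⇔-trans (holdsN-≡ r gap refl) (⇔-sym (scale-pos r p d)))

lower-bound-sound : ∀ r {x b p} d .{{_ : Negative d}} → x - b ≡ p * d → holdsN r b x ⇔ holdsN r p 0ℚ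
lower-bound-sound r {x} {b} {p} d gap =
  ⇔-trans (holdsN-sub′ r b x) (⇔-trans (holdsN-≡ r refl gap) (⇔-sym (scale-neg r p d)))

eq-bound-sound : ∀ {x b p} d .{{_ : NonZero d}} → x - b ≡ p * d → x ≡ b ⇔ p ≡ 0ℚ
eq-bound-sound {x} {b} {p} d gap =
  ⇔-trans (holdsN-sub neq x b) (⇔-trans (holdsN-≡ neq gap refl) (⇔-sym (≡0-scale p d)))

1/nonZero : ∀ {c} (c≢0 : c ≢ 0ℚ) → NonZero ((1/ c) {{≢-nonZero c≢0}})
1/nonZero {c} c≢0 = nonZero⇒1/nonZero c {{≢-nonZero c≢0}}

≮0∧≢0⇒positive : ∀ {c} → ¬ c < 0ℚ → c ≢ 0ℚ → Positive c
≮0∧≢0⇒positive c≮0 c≢0 = positive (≤∧≢⇒< (≮⇒≥ c≮0) (c≢0 ∘ sym))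

leadBound-sound : ∀ {n} r (P : Poly n) ld w → holdsB (leadBound r P ld) w ⇔ holdsN r (eval P w) 0ℚ
leadBound-sound r P (lead k c c≢0) w with c <? 0ℚ
leadBound-sound nlt P (lead k c c≢0) w | yes c<0 =
  lower-bound-sound nlt _ {{1/neg⇒neg c {{negative c<0}}}} (leading-gap P k c c≢0 w)
leadBound-sound nle P (lead k c c≢0) w | yes c<0 =
  lower-bound-sound nle _ {{1/neg⇒neg c {{negative c<0}}}} (leading-gap P k c c≢0 w)
leadBound-sound nlt P (lead k c c≢0) w | no c≮0 =
  upper-bound-sound nlt _ {{1/pos⇒pos c {{≮0∧≢0⇒positive c≮0 c≢0}}}} (leading-gap P k c c≢0 w)
leadBound-sound nle P (lead k c c≢0) w | no c≮0 =
  upper-bound-sound nle _ {{1/pos⇒pos c {{≮0∧≢0⇒positive c≮0 c≢0}}}} (leading-gap P k c c≢0 w)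
leadBound-sound neq P (lead k c c≢0) w | _ =
  eq-bound-sound _ {{1/nonZero c≢0}} (leading-gap P k c c≢0 w)

Generalizes : ∀ {n} → Vector n → (Vector n → Set) → Region n → Set
Generalizes v S (pos T) = holdsT T v × S v × (∀ w → holdsT T w → S w)
Generalizes v S (neg T) = holdsT T v × ¬ S v × (∀ w → S w → ¬ holdsT T w)

generalizes-cong : ∀ {n} {v : Vector n} {S S′ : Vector n → Set} R →
  (∀ w → S w ⇔ S′ w) → Generalizes v S R → Generalizes v S′ R
generalizes-cong {v = v} (pos T) S⇔S′ (Tv , Sv , T⊆S) =
  Tv , Equivalence.to (S⇔S′ v) Sv , λ w → Equivalence.to (S⇔S′ w) ∘ T⊆S w
generalizes-cong {v = v} (neg T) S⇔S′ (Tv , ¬Sv , S⊆∼T) =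
  Tv , ¬Sv ∘ Equivalence.from (S⇔S′ v) , λ w → S⊆∼T w ∘ Equivalence.from (S⇔S′ w)

complement-generalizes : ∀ {n} {v : Vector n} {S : Vector n → Set} R →
  Generalizes v S R → Generalizes v (¬_ ∘ S) (∼ R)
complement-generalizes (pos T) (Tv , Sv , T⊆S)   = Tv , (λ ¬Sv → ¬Sv Sv) , λ w ¬Sw Tw → ¬Sw (T⊆S w Tw)
complement-generalizes (neg T) (Tv , ¬Sv , S⊆∼T) = Tv , ¬Sv , λ w Tw Sw → S⊆∼T w Sw Tw

constRegion-generalizes : ∀ {n} (v : Vector n) r c →
  Generalizes v (λ _ → holdsN r c 0ℚ) (constRegion r c)
constRegion-generalizes v nlt c with c <? 0ℚ
... | yes c<0 = [] , c<0 , λ _ _ → c<0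
... | no  c≮0 = [] , c≮0 , λ _ c<0 _ → c≮0 c<0
constRegion-generalizes v nle c with c ≤? 0ℚ
... | yes c≤0 = [] , c≤0 , λ _ _ → c≤0
... | no  c≰0 = [] , c≰0 , λ _ c≤0 _ → c≰0 c≤0
constRegion-generalizes v neq c with c ≟ 0ℚ
... | yes c≡0 = [] , c≡0 , λ _ _ → c≡0
... | no  c≢0 = [] , c≢0 , λ _ c≡0 _ → c≢0 c≡0

module _ {n : ℕ} {v : Vector n} where

  single-pos : ∀ {b} → holdsB b v → Generalizes v (holdsB b) (pos (b ∷ []))
  single-pos bv = bv ∷ [] , bv , λ _ → head

  single-neg : ∀ b b′ → holdsB b′ v → ¬ holdsB b v → (∀ {w} → holdsB b w → ¬ holdsB b′ w) →
               Generalizes v (holdsB b) (neg (b′ ∷ []))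
  single-neg _ _ b′v ¬bv b⊆∼b′ = b′v ∷ [] , ¬bv , λ _ bw b′w → b⊆∼b′ bw (head b′w)

  boundRegion-generalizes : ∀ b → Generalizes v (holdsB b) (boundRegion v b)
  boundRegion-generalizes b@(bound k ltU P) with v k <? eval P v
  ... | yes h = single-pos h
  ... | no ¬h = single-neg b (bound k leL P) (≮⇒≥ ¬h) ¬h <⇒≱
  boundRegion-generalizes b@(bound k leU P) with v k ≤? eval P v
  ... | yes h = single-pos h
  ... | no ¬h = single-neg b (bound k ltL P) (≰⇒> ¬h) ¬h ≤⇒≯
  boundRegion-generalizes b@(bound k ltL P) with eval P v <? v k
  ... | yes h = single-pos h
  ... | no ¬h = single-neg b (bound k leU P) (≮⇒≥ ¬h) ¬h <⇒≱
  boundRegion-generalizes b@(bound k leL P) with eval P v ≤? v k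
  ... | yes h = single-pos h
  ... | no ¬h = single-neg b (bound k ltU P) (≰⇒> ¬h) ¬h ≤⇒≯
  boundRegion-generalizes b@(bound k eqB P) with v k ≟ eval P v
  ... | yes h = single-pos h
  ... | no ¬h with eval P v <? v k
  ...   | yes above = single-neg b (bound k ltL P) above ¬h (<-irrefl ∘ sym)
  ...   | no ¬above = single-neg b (bound k ltU P) (≤∧≢⇒< (≮⇒≥ ¬above) ¬h) ¬h <-irrefl

  atomRegion-generalizes : ∀ L → Generalizes v (holdsC L) (atomRegion v L)
  atomRegion-generalizes L with normalize L | normalize-sound L
  ... | P , r | L⇔P≺0 with leading (coef P) in eq
  ...   | nothing = generalizes-cong (constRegion r (const P))
            (λ w → ⇔-sym (⇔-trans (L⇔P≺0 w) (holdsN-≡ r (P≡c₀ w) refl)))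
            (constRegion-generalizes v r (const P))
    where
    P≡c₀ : ∀ w → eval P w ≡ const P
    P≡c₀ w = eval-constant P w (leading-nothing (coef P) eq)
  ...   | just ld = generalizes-cong (boundRegion v (leadBound r P ld))
            (λ w → ⇔-trans (leadBound-sound r P ld w) (⇔-sym (L⇔P≺0 w)))
            (boundRegion-generalizes (leadBound r P ld))

module _ {n : ℕ} {v : Vector n} where

  side-condition : ∀ L {T₀} → atomRegion v L ≡ pos T₀ →
                   holdsT T₀ v × (∀ w → holdsT T₀ w → holdsC L w)
  side-condition L {T₀} <L>≡T₀
    with subst (Generalizes v (holdsC L)) <L>≡T₀ (atomRegion-generalizes L)
  ... | T₀v , _ , T₀⊆L = T₀v , T₀⊆L

  -- replacing b₁ ∩ b₂ by b₁ ∩ {T₀} is sound: T₀ holds at v and, together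
  -- with b₁, implies b₂
  record SoundRule (b₁ b₂ : Bound n) (T₀ : Trapezoid n) : Set where
    constructor sound-rule
    field
      side-at-v : holdsT T₀ v
      entails   : ∀ w → holdsB b₁ w → holdsT T₀ w → holdsB b₂ w

  rule-sound : ∀ {b₁ b₂} L {T₀} → atomRegion v L ≡ pos T₀ →
    (∀ {w} → holdsB b₁ w → holdsC L w → holdsB b₂ w) → SoundRule b₁ b₂ T₀
  rule-sound L <L>≡T₀ b₁∧L⇒b₂ with side-condition L <L>≡T₀
  ... | T₀v , T₀⊆L = sound-rule T₀v λ w b₁w T₀w → b₁∧L⇒b₂ b₁w (T₀⊆L w T₀w)

  combine-sound : ∀ {b₁ b₂ b T₀} → Combine v b₁ b₂ b T₀ → b ≡ b₁ × SoundRule b₁ b₂ T₀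
  combine-sound (uu-ltlt {P = P} {Q} _ side) = refl , rule-sound (P ⟨ LE ⟩ Q) side <-≤-trans
  combine-sound (uu-ltle {P = P} {Q} _ side) = refl , rule-sound (P ⟨ LE ⟩ Q) side
    λ x<P P≤Q → <⇒≤ (<-≤-trans x<P P≤Q)
  combine-sound (uu-lelt {P = P} {Q} _ side) = refl , rule-sound (P ⟨ LT ⟩ Q) side ≤-<-trans
  combine-sound (uu-lele {P = P} {Q} _ side) = refl , rule-sound (P ⟨ LE ⟩ Q) side ≤-trans
  combine-sound (ll-ltlt {P = P} {Q} _ side) = refl , rule-sound (Q ⟨ LE ⟩ P) side
    λ P<x Q≤P → ≤-<-trans Q≤P P<x
  combine-sound (ll-ltle {P = P} {Q} _ side) = refl , rule-sound (Q ⟨ LE ⟩ P) side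
    λ P<x Q≤P → ≤-trans Q≤P (<⇒≤ P<x)
  combine-sound (ll-lelt {P = P} {Q} _ side) = refl , rule-sound (Q ⟨ LT ⟩ P) side
    λ P≤x Q<P → <-≤-trans Q<P P≤x
  combine-sound (ll-lele {P = P} {Q} _ side) = refl , rule-sound (Q ⟨ LE ⟩ P) side
    λ P≤x Q≤P → ≤-trans Q≤P P≤x
  combine-sound (eq-ltU {P = P} {Q} side) = refl , rule-sound (P ⟨ LT ⟩ Q) side
    λ x≡P P<Q → subst (_< _) (sym x≡P) P<Q
  combine-sound (eq-leU {P = P} {Q} side) = refl , rule-sound (P ⟨ LE ⟩ Q) side
    λ x≡P P≤Q → subst (_≤ _) (sym x≡P) P≤Q
  combine-sound (eq-ltL {P = P} {Q} side) = refl , rule-sound (Q ⟨ LT ⟩ P) side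
    λ x≡P Q<P → subst (_ <_) (sym x≡P) Q<P
  combine-sound (eq-leL {P = P} {Q} side) = refl , rule-sound (Q ⟨ LE ⟩ P) side
    λ x≡P Q≤P → subst (_ ≤_) (sym x≡P) Q≤P
  combine-sound (eq-eq  {P = P} {Q} side) = refl , rule-sound (P ⟨ EQ ⟩ Q) side trans

  Refines : Trapezoid n → Trapezoid n → Set
  Refines T T′ = (holdsT T v → holdsT T′ v) × (∀ w → holdsT T′ w → holdsT T w)

  step-sound : ∀ {T T′} → Step v T T′ → Refines T T′
  step-sound (step {b₁ = b₁} {b₂} {rest} {T₀ = T₀} perm rule) with combine-sound rule
  ... | refl , sound-rule T₀v entails =
    atV ∘ All-resp-↭ perm , λ w → All-resp-↭ (↭-sym perm) ∘ contained w
    where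
    atV : holdsT (b₁ ∷ b₂ ∷ rest) v → holdsT (b₁ ∷ T₀ ++ rest) v
    atV (b₁v ∷ _ ∷ restv) = b₁v ∷ ++⁺ T₀v restv
    contained : ∀ w → holdsT (b₁ ∷ T₀ ++ rest) w → holdsT (b₁ ∷ b₂ ∷ rest) w
    contained w (b₁w ∷ T₀restw) with ++⁻ T₀ T₀restw
    ... | T₀w , restw = b₁w ∷ entails w b₁w T₀w ∷ restw

  steps-sound : ∀ {T T′} → Star (Step v) T T′ → Refines T T′
  steps-sound ε          = (λ Tv → Tv) , (λ _ Tw → Tw)
  steps-sound (s ◅ ss) with step-sound s | steps-sound ss
  ... | atV , contained | atV′ , contained′ = atV′ ∘ atV , λ w → contained w ∘ contained′ w

  intersection-generalizes : ∀ {S₁ S₂ : Vector n → Set} {R₁ R₂ R} →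
    Generalizes v S₁ R₁ → Generalizes v S₂ R₂ → Inter v R₁ R₂ R → Generalizes v (λ w → S₁ w × S₂ w) R
  intersection-generalizes (Tav , S₁v , Ta⊆S₁) (Tbv , S₂v , Tb⊆S₂) (pospos {Ta = Ta} steps _)
    with steps-sound steps
  ... | atV , contained =
    atV (++⁺ Tav Tbv) , (S₁v , S₂v) , λ w → map (Ta⊆S₁ w) (Tb⊆S₂ w) ∘ ++⁻ Ta ∘ contained w
  intersection-generalizes (Tv , ¬S₁v , S₁⊆∼T) _ negˡ = Tv , ¬S₁v ∘ proj₁ , λ w → S₁⊆∼T w ∘ proj₁
  intersection-generalizes _ (Tv , ¬S₂v , S₂⊆∼T) negʳ = Tv , ¬S₂v ∘ proj₂ , λ w → S₂⊆∼T w ∘ proj₂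

holdsRel? : ∀ o p q → Dec (holdsRel o p q)
holdsRel? EQ p q = p ≟ q
holdsRel? LT p q = p <? q
holdsRel? LE p q = p ≤? q
holdsRel? GT p q = q <? p
holdsRel? GE p q = q ≤? p

holdsF? : ∀ {n} (F : Formula n) w → Dec (holdsF F w)
holdsF? (atom (P ⟨ o ⟩ Q)) w = holdsRel? o (eval P w) (eval Q w)
holdsF? (F ∧F G) w = holdsF? F w ×-dec holdsF? G w
holdsF? (F ∨F G) w = holdsF? F w ⊎-dec holdsF? G w
holdsF? (¬F F)   w = ¬? (holdsF? F w)

de-morgan : ∀ {A B : Set} → Dec (A ⊎ B) → (¬ (¬ A × ¬ B)) ⇔ (A ⊎ B)
de-morgan A∨B? = mk⇔
  (λ ¬¬A∨B → decidable-stable A∨B? (λ ¬A∨B → ¬¬A∨B (¬A∨B ∘ inj₁ , ¬A∨B ∘ inj₂)))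
  (λ A∨B ¬A∧¬B → [ proj₁ ¬A∧¬B , proj₂ ¬A∧¬B ] A∨B)

gen-generalizes : ∀ {n} {v : Vector n} {F R} → Gen v F R → Generalizes v (holdsF F) R
gen-generalizes (gen-atom {L}) = atomRegion-generalizes L
gen-generalizes (gen-and g₁ g₂ R₁∩R₂) =
  intersection-generalizes (gen-generalizes g₁) (gen-generalizes g₂) R₁∩R₂
gen-generalizes (gen-not {R = R} g) = complement-generalizes R (gen-generalizes g)
gen-generalizes (gen-or {F₁ = F₁} {F₂} {R₁} {R₂} {R} g₁ g₂ ∼R₁∩∼R₂) =
  generalizes-cong (∼ R) (λ w → de-morgan (holdsF? (F₁ ∨F F₂) w))
    (complement-generalizes R
      (intersection-generalizes (complement-generalizes R₁ (gen-generalizes g₁))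
                                (complement-generalizes R₂ (gen-generalizes g₂)) ∼R₁∩∼R₂))

generalizes⇒invariants : ∀ {n} {v : Vector n} {S : Vector n → Set} R → Generalizes v S R →
  (S v ⇔ holdsR R v) × (S v → ∀ w → holdsR R w → S w) × (¬ S v → ∀ w → S w → holdsR R w)
generalizes⇒invariants (pos T) (Tv , Sv , T⊆S) =
  mk⇔ (λ _ → Tv) (λ _ → Sv) , (λ _ → T⊆S) , (λ ¬Sv → ⊥-elim (¬Sv Sv))
generalizes⇒invariants (neg T) (Tv , ¬Sv , S⊆∼T) =
  mk⇔ (⊥-elim ∘ ¬Sv) (λ ¬Tv → ⊥-elim (¬Tv Tv)) , (⊥-elim ∘ ¬Sv) , (λ _ → S⊆∼T)

mainTheorem3 : ∀ {n : ℕ} (ty : Fin n → VarType) (F : Formula n) (v : Vector n) (R : Region n) →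
    Consistent ty v → Gen v F R →
    (holdsF F v ⇔ holdsR R v)
    × (holdsF F v → ∀ (w : Vector n) → Consistent ty w → holdsR R w → holdsF F w)
    × (¬ holdsF F v → ∀ (w : Vector n) → Consistent ty w → holdsF F w → holdsR R w)
mainTheorem3 ty F v R _ F⇒R with generalizes⇒invariants R (gen-generalizes F⇒R)
... | invariant₁ , invariant₂ₐ , invariant₂ᵦ =
  invariant₁ , (λ Fv w _ → invariant₂ₐ Fv w) , (λ ¬Fv w _ → invariant₂ᵦ ¬Fv w)
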